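{- For every integer $n\ge3$, $$S_n^{D,+}-S_n^{D,- }=S_{n-2}^{D,- }-S_{n-2}^{D,+},\qquad S_n^{B-D,+}-S_n^{B-D,- }=S_{n-2}^{B-D,- }-S_{n-2}^{B-D,+}.$$ Consequently, for every positive integer $n$, $$S_n^{D,+}-S_n^{D,- }=\begin{cases}1& n\equiv0,1\pmod4,\\ -1& n\equiv 2,3\pmod 4,\end{cases}\qquad S_n^{B-D,+}-S_n^{B-D,- }=0.$$
   Context: $\mathfrak{B}_n$ is the group of signed permutations in window notation $\pi=\pi_1\cdots\pi_n$ ($\pi_i\in\{\pm1,\dots,\pm n\}$, $\{|\pi_i|\}=[n]$), and $\mathfrak{D}_n$ the subset with an even number of negative entries. For $\pi\in\mathfrak{B}_n$, $\mathrm{inv}_D(\pi)=|\{i<j:\pi_i>\pi_j\}|+|\{i<j:-\pi_i>\pi_j\}|$. A snake is $\pi\in\mathfrak{B}_n$ with $0<\pi_1>\pi_2<\pi_3>\cdots$. $S_n^{D,+}$ (resp. $S_n^{D,- }$) is the number of snakes in $\mathfrak{D}_n$ with $\mathrm{inv}_D$ even (resp. odd); $S_n^{B-D,+}$ (resp. $S_n^{B-D,- }$) is the number of snakes in $\mathfrak{B}_n\setminus\mathfrak{D}_n$ with $\mathrm{inv}_D$ even (resp. odd). -}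

module Defs where

open import Data.Bool using (Bool; true; false; _∧_; not; if_then_else_)
open import Data.Nat as ℕ using (ℕ; zero; suc)
open import Data.Integer as ℤ using (ℤ; +_; -_; ∣_∣; _-_)
open import Data.List using (List; []; _∷_; map; concatMap; filter; length; upTo; _++_)
open import Relation.Nullary.Decidable using (⌊_⌋)
open import Relation.Binary.PropositionalEquality using (_≡_)

entries : ℕ → List ℤ
entries n = map (λ k → + suc k) (upTo n) ++ map (λ k → - (+ suc k)) (upTo n)

words : ℕ → ℕ → List (List ℤ)
words n zero    = [] ∷ []
words n (suc k) = concatMap (λ x → map (x ∷_) (words n k)) (entries n)

memℕ : ℕ → List ℕ → Bool
memℕ x []       = false
memℕ x (y ∷ ys) = if ⌊ x ℕ.≟ y ⌋ then true else memℕ x ys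

distinct : List ℕ → Bool
distinct []       = true
distinct (x ∷ xs) = not (memℕ x xs) ∧ distinct xs

filterᵇ : {A : Set} → (A → Bool) → List A → List A
filterᵇ p []       = []
filterᵇ p (x ∷ xs) = if p x then x ∷ filterᵇ p xs else filterᵇ p xs

-- Signed permutations of [n] (the group 𝔅ₙ) in window notation π₁⋯πₙ:
-- words of length n over {±1,…,±n} whose absolute values are pairwise
-- distinct (hence {|πᵢ|} = [n]).
signedPerms : ℕ → List (List ℤ)
signedPerms n = filterᵇ (λ w → distinct (map ∣_∣ w)) (words n n)

_<ᵇ_ : ℤ → ℤ → Bool
infix 4 _<ᵇ_
x <ᵇ y = ⌊ x ℤ.<? y ⌋

negCount : List ℤ → ℕ
negCount []       = 0
negCount (x ∷ xs) = (if x <ᵇ (+ 0) then 1 else 0) ℕ.+ negCount xs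

isEven : ℕ → Bool
isEven zero          = true
isEven (suc zero)    = false
isEven (suc (suc n)) = isEven n

inD : List ℤ → Bool
inD w = isEven (negCount w)

-- inv_D(π) = #{i<j : πᵢ > πⱼ} + #{i<j : -πᵢ > πⱼ}
invFrom : ℤ → List ℤ → ℕ
invFrom x []       = 0
invFrom x (y ∷ ys) = (if y <ᵇ x then 1 else 0) ℕ.+ (if y <ᵇ (- x) then 1 else 0) ℕ.+ invFrom x ys

invD : List ℤ → ℕ
invD []       = 0
invD (x ∷ xs) = invFrom x xs ℕ.+ invD xs

-- alternating pattern π₁ > π₂ < π₃ > ⋯ ; the flag says whether the next
-- comparison is a descent
alt : Bool → List ℤ → Bool
alt d []           = true
alt d (x ∷ [])     = true
alt d (x ∷ y ∷ r)  = (if d then y <ᵇ x else x <ᵇ y) ∧ alt (not d) (y ∷ r)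

isSnake : List ℤ → Bool
isSnake []       = false
isSnake (x ∷ xs) = ((+ 0) <ᵇ x) ∧ alt true (x ∷ xs)

count : {A : Set} → (A → Bool) → List A → ℕ
count p xs = length (filterᵇ p xs)

SD⁺ SD⁻ SBD⁺ SBD⁻ : ℕ → ℕ
SD⁺  n = count (λ w → isSnake w ∧ inD w ∧ isEven (invD w)) (signedPerms n)
SD⁻  n = count (λ w → isSnake w ∧ inD w ∧ not (isEven (invD w))) (signedPerms n)
SBD⁺ n = count (λ w → isSnake w ∧ not (inD w) ∧ isEven (invD w)) (signedPerms n)
SBD⁻ n = count (λ w → isSnake w ∧ not (inD w) ∧ not (isEven (invD w))) (signedPerms n)

ΔD ΔBD : ℕ → ℤ
ΔD  n = + SD⁺ n - + SD⁻ n
ΔBD n = + SBD⁺ n - + SBD⁻ n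

-- Snakes are counted letter by letter.  Appending a letter y to a partial signed
-- permutation changes the parity of inv_D by the number of still unused absolute values
-- below ∣ y ∣, and changes (-1)^neg by the sign of y.  So the signed count of all
-- completions of a prefix ending in x depends only on the number k of unused values, the
-- rank of ∣ x ∣ among them, the sign of x and the direction of the next comparison.  This
-- quantity obeys a linear recursion in k whose solution vanishes as soon as two unused
-- values lie below ∣ x ∣, and is otherwise a combination of ε k = (-1)^⌊k/2⌋ and ε (k+1);
-- the recursion is verified on one period of ε.  Counting with and without the twist by
-- (-1)^neg gives 2 Δ^D_n = ε n + ε n and 2 Δ^{B-D}_n = ε n - ε n.

module Submission where

open import Defs
open import Data.Nat using (ℕ; _≤_; _%_; _∸_)
open import Data.Integer using (ℤ; +_; -_)
open import Data.Product using (_×_)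
open import Data.Sum using (_⊎_)
open import Relation.Binary.PropositionalEquality using (_≡_)

open import Data.Bool using (Bool; true; false; _∧_; not; if_then_else_)
open import Data.Bool.ListAction using (all)
open import Data.Bool.Properties using (∧-conicalˡ; ∧-conicalʳ; ∧-zeroʳ; not-injective; ∧-commutativeMonoid)
open import Algebra.Solver.CommutativeMonoid ∧-commutativeMonoid using (solve; _⊜_; _⊕_)
open import Data.Empty using (⊥-elim)
open import Data.Integer as ℤ using (-[1+_]; _+_; _-_; _*_; ∣_∣)
import Data.Integer.Properties as ℤ
open import Algebra.Properties.CommutativeSemigroup ℤ.+-commutativeSemigroup using () renaming (interchange to +-interchange)
open import Data.Integer.Tactic.RingSolver using (solve-∀)
open import Data.List using (List; []; _∷_; _++_; map; filter; concat; concatMap; length; upTo; applyUpTo)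
import Data.List.Properties as List
open import Data.List.Relation.Unary.All as All using (All; []; _∷_)
import Data.List.Relation.Unary.All.Properties as All
open import Data.List.Relation.Unary.AllPairs as AllPairs using (AllPairs; []; _∷_)
import Data.List.Relation.Unary.AllPairs.Properties as AllPairs
open import Data.Nat as ℕ using (zero; suc; s≤s; z≤n; _<_; _<?_; _≤?_)
import Data.Nat.Properties as ℕ
open import Data.Nat.DivMod using ([m+n]%n≡m%n)
open import Data.Product using (_,_; proj₁; proj₂)
open import Data.Sum using (inj₁; inj₂)
open import Relation.Binary.Definitions using (tri<; tri≈; tri>)
open import Relation.Binary.PropositionalEquality using (_≢_; refl; sym; trans; cong; cong₂; subst; module ≡-Reasoning)
open import Relation.Nullary using (¬_; Dec; yes; no; contradiction)
open import Relation.Nullary.Decidable using (⌊_⌋; T?; isYes≗does; dec-true; dec-false)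

sign : ℕ → ℤ
sign zero          = + 1
sign (suc zero)    = - + 1
sign (suc (suc n)) = sign n

sign-+ : ∀ m n → sign (m ℕ.+ n) ≡ sign m * sign n
sign-+ zero          n = sym (ℤ.*-identityˡ (sign n))
sign-+ (suc zero)    n = sign-suc n
  where
  sign-suc : ∀ n → sign (suc n) ≡ - + 1 * sign n
  sign-suc zero          = refl
  sign-suc (suc zero)    = refl
  sign-suc (suc (suc n)) = sign-suc n
sign-+ (suc (suc m)) n = sign-+ m n

signᵇ : Bool → ℤ
signᵇ true  = + 1
signᵇ false = - + 1

sign≡signᵇ-isEven : ∀ n → sign n ≡ signᵇ (isEven n)
sign≡signᵇ-isEven zero          = refl
sign≡signᵇ-isEven (suc zero)    = refl
sign≡signᵇ-isEven (suc (suc n)) = sign≡signᵇ-isEven n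

𝟙 : Bool → ℤ
𝟙 true  = + 1
𝟙 false = + 0

𝟙-∧ : ∀ a b → 𝟙 (a ∧ b) ≡ 𝟙 a * 𝟙 b
𝟙-∧ true  b = sym (ℤ.*-identityˡ (𝟙 b))
𝟙-∧ false b = sym (ℤ.*-zeroˡ (𝟙 b))

𝟙*-cong : ∀ b {x y} → (b ≡ true → x ≡ y) → 𝟙 b * x ≡ 𝟙 b * y
𝟙*-cong true  x≡y = cong (_*_ (+ 1)) (x≡y refl)
𝟙*-cong false {x} {y} _ = trans (ℤ.*-zeroˡ x) (sym (ℤ.*-zeroˡ y))

∧-≡true : ∀ {a b} → a ∧ b ≡ true → a ≡ true × b ≡ true
∧-≡true {a} {b} h = ∧-conicalˡ a b h , ∧-conicalʳ a b h

⌊⌋-true : ∀ {a} {A : Set a} (a? : Dec A) → A → ⌊ a? ⌋ ≡ true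
⌊⌋-true a? x = trans (isYes≗does a?) (dec-true a? x)

⌊⌋-false : ∀ {a} {A : Set a} (a? : Dec A) → ¬ A → ⌊ a? ⌋ ≡ false
⌊⌋-false a? ¬x = trans (isYes≗does a?) (dec-false a? ¬x)

⌊⌋≡true⇒ : ∀ {a} {A : Set a} (a? : Dec A) → ⌊ a? ⌋ ≡ true → A
⌊⌋≡true⇒ (yes x) _ = x
⌊⌋≡true⇒ (no _) ()

Σ : {A : Set} → (A → ℤ) → List A → ℤ
Σ f []       = + 0
Σ f (x ∷ xs) = f x + Σ f xs

module _ {A : Set} where

  Σ-++ : ∀ (f : A → ℤ) xs ys → Σ f (xs ++ ys) ≡ Σ f xs + Σ f ys
  Σ-++ f []       ys = sym (ℤ.+-identityˡ _)
  Σ-++ f (x ∷ xs) ys = trans (cong (_+_ (f x)) (Σ-++ f xs ys)) (sym (ℤ.+-assoc (f x) _ _))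

  Σ-+ : ∀ (f g : A → ℤ) xs → Σ (λ x → f x + g x) xs ≡ Σ f xs + Σ g xs
  Σ-+ f g []       = refl
  Σ-+ f g (x ∷ xs) = trans (cong (_+_ (f x + g x)) (Σ-+ f g xs)) (+-interchange (f x) (g x) _ _)

  Σ-neg : ∀ (f : A → ℤ) xs → Σ (λ x → - f x) xs ≡ - Σ f xs
  Σ-neg f []       = refl
  Σ-neg f (x ∷ xs) = trans (cong (_+_ (- f x)) (Σ-neg f xs)) (sym (ℤ.neg-distrib-+ (f x) (Σ f xs)))

  Σ-*ˡ : ∀ c (f : A → ℤ) xs → Σ (λ x → c * f x) xs ≡ c * Σ f xs
  Σ-*ˡ c f []       = sym (ℤ.*-zeroʳ c)
  Σ-*ˡ c f (x ∷ xs) = trans (cong (_+_ (c * f x)) (Σ-*ˡ c f xs)) (sym (ℤ.*-distribˡ-+ c (f x) (Σ f xs)))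

  Σ-cong : ∀ {f g : A → ℤ} xs → (∀ x → f x ≡ g x) → Σ f xs ≡ Σ g xs
  Σ-cong []       f≗g = refl
  Σ-cong (x ∷ xs) f≗g = cong₂ _+_ (f≗g x) (Σ-cong xs f≗g)

  Σ-cong-All : ∀ {P : A → Set} {f g : A → ℤ} {xs} → All P xs → (∀ {x} → P x → f x ≡ g x) → Σ f xs ≡ Σ g xs
  Σ-cong-All []         f≗g = refl
  Σ-cong-All (px ∷ pxs) f≗g = cong₂ _+_ (f≗g px) (Σ-cong-All pxs f≗g)

  Σ-zero : ∀ {f : A → ℤ} xs → All (λ x → f x ≡ + 0) xs → Σ f xs ≡ + 0
  Σ-zero []       []             = refl
  Σ-zero (x ∷ xs) (fx≡0 ∷ fxs≡0) = cong₂ _+_ fx≡0 (Σ-zero xs fxs≡0)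

  Σ-filterᵇ : ∀ (p : A → Bool) (f : A → ℤ) xs → Σ f (filterᵇ p xs) ≡ Σ (λ x → 𝟙 (p x) * f x) xs
  Σ-filterᵇ p f []       = refl
  Σ-filterᵇ p f (x ∷ xs) with p x
  ... | true  = cong₂ _+_ (sym (ℤ.*-identityˡ (f x))) (Σ-filterᵇ p f xs)
  ... | false = trans (Σ-filterᵇ p f xs) (sym (ℤ.+-identityˡ _))

  count≡Σ𝟙 : ∀ (p : A → Bool) xs → + count p xs ≡ Σ (λ x → 𝟙 (p x)) xs
  count≡Σ𝟙 p []       = refl
  count≡Σ𝟙 p (x ∷ xs) with p x
  ... | true  = trans (ℤ.pos-+ 1 (count p xs)) (cong (_+_ (+ 1)) (count≡Σ𝟙 p xs))
  ... | false = trans (count≡Σ𝟙 p xs) (sym (ℤ.+-identityˡ _))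

module _ {A B : Set} where

  Σ-map : ∀ (f : B → ℤ) (g : A → B) xs → Σ f (map g xs) ≡ Σ (λ x → f (g x)) xs
  Σ-map f g []       = refl
  Σ-map f g (x ∷ xs) = cong (_+_ (f (g x))) (Σ-map f g xs)

  Σ-concatMap : ∀ (f : B → ℤ) (g : A → List B) xs → Σ f (concatMap g xs) ≡ Σ (λ x → Σ f (g x)) xs
  Σ-concatMap f g []       = refl
  Σ-concatMap f g (x ∷ xs) = trans (Σ-++ f (g x) (concat (map g xs))) (cong (_+_ (Σ f (g x))) (Σ-concatMap f g xs))

_∈ᵇ_ _∉ᵇ_ : ℕ → List ℕ → Set
v ∈ᵇ L = memℕ v L ≡ true
v ∉ᵇ L = memℕ v L ≡ false

_⊆ᵇ_ : List ℕ → List ℕ → Set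
W ⊆ᵇ C = All (_∈ᵇ C) W

memℕ-here : ∀ v L → v ∈ᵇ (v ∷ L)
memℕ-here v L rewrite ⌊⌋-true (v ℕ.≟ v) refl = refl

memℕ-there : ∀ {v u} L → v ≢ u → memℕ v (u ∷ L) ≡ memℕ v L
memℕ-there {v} {u} L v≢u rewrite ⌊⌋-false (v ℕ.≟ u) v≢u = refl

∉ᵇ-∈ᵇ⇒≢ : ∀ {v u} L → v ∉ᵇ L → u ∈ᵇ L → v ≢ u
∉ᵇ-∈ᵇ⇒≢ L v∉ u∈ refl with () ← trans (sym v∉) u∈

⊆ᵇ-refl : ∀ L → L ⊆ᵇ L
⊆ᵇ-refl []      = []
⊆ᵇ-refl (u ∷ L) = memℕ-here u L ∷ All.map there (⊆ᵇ-refl L)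
  where
  there : ∀ {v} → v ∈ᵇ L → v ∈ᵇ (u ∷ L)
  there {v} v∈ with v ℕ.≟ u
  ... | yes _ = refl
  ... | no  _ = v∈

∈ᵇ-filterᵇ : ∀ p {v} L → v ∈ᵇ L → p v ≡ true → v ∈ᵇ filterᵇ p L
∈ᵇ-filterᵇ p {v} (u ∷ L) v∈ pv with v ℕ.≟ u
... | yes refl rewrite pv = memℕ-here v (filterᵇ p L)
... | no v≢u with p u
...   | true  = trans (memℕ-there (filterᵇ p L) v≢u) (∈ᵇ-filterᵇ p L v∈ pv)
...   | false = ∈ᵇ-filterᵇ p L v∈ pv

∉ᵇ-filterᵇ : ∀ p {v} L → v ∉ᵇ L → v ∉ᵇ filterᵇ p L
∉ᵇ-filterᵇ p     []      v∉ = refl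
∉ᵇ-filterᵇ p {v} (u ∷ L) v∉ with v ℕ.≟ u
... | no v≢u with p u
...   | true  = trans (memℕ-there (filterᵇ p L) v≢u) (∉ᵇ-filterᵇ p L v∉)
...   | false = ∉ᵇ-filterᵇ p L v∉

⊆ᵇ-filterᵇ : ∀ p C {W} → W ⊆ᵇ C → filterᵇ p W ⊆ᵇ filterᵇ p C
⊆ᵇ-filterᵇ p C []                           = []
⊆ᵇ-filterᵇ p C {w ∷ W} (w∈ ∷ W⊆) with p w in pw
... | true  = ∈ᵇ-filterᵇ p C w∈ pw ∷ ⊆ᵇ-filterᵇ p C W⊆
... | false = ⊆ᵇ-filterᵇ p C W⊆

distinct-filterᵇ : ∀ p W → distinct W ≡ true → distinct (filterᵇ p W) ≡ true
distinct-filterᵇ p []      _ = refl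
distinct-filterᵇ p (w ∷ W) d with ∧-≡true {not (memℕ w W)} d
... | w∉ , dW with p w
...   | true rewrite ∉ᵇ-filterᵇ p W (not-injective w∉) = distinct-filterᵇ p W dW
...   | false = distinct-filterᵇ p W dW

filterᵇ≡filter : ∀ {A : Set} (p : A → Bool) xs → filterᵇ p xs ≡ filter (λ x → T? (p x)) xs
filterᵇ≡filter p []       = refl
filterᵇ≡filter p (x ∷ xs) with p x
... | true  = cong (x ∷_) (filterᵇ≡filter p xs)
... | false = filterᵇ≡filter p xs

length-filterᵇ : ∀ {A : Set} (p : A → Bool) xs → length (filterᵇ p xs) ≤ length xs
length-filterᵇ p xs rewrite filterᵇ≡filter p xs = List.length-filter (λ x → T? (p x)) xs

count+count-not : ∀ {A : Set} (p : A → Bool) xs → count p xs ℕ.+ count (λ x → not (p x)) xs ≡ length xs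
count+count-not p []       = refl
count+count-not p (x ∷ xs) with p x
... | true  = cong suc (count+count-not p xs)
... | false = trans (ℕ.+-suc _ _) (cong suc (count+count-not p xs))

bit : Bool → ℕ
bit b = if b then 1 else 0

count-∷ : ∀ {A : Set} (p : A → Bool) x xs → count p (x ∷ xs) ≡ bit (p x) ℕ.+ count p xs
count-∷ p x xs with p x
... | true  = refl
... | false = refl

delete : ℕ → List ℕ → List ℕ
delete u = filterᵇ (λ v → not ⌊ v ℕ.≟ u ⌋)

length-delete< : ∀ {u} C → u ∈ᵇ C → length (delete u C) < length C
length-delete< {u} (v ∷ C) u∈ with v ℕ.≟ u
... | yes refl = s≤s (length-filterᵇ _ C)
... | no v≢u   = s≤s (length-delete< C (trans (sym (memℕ-there C (λ u≡v → v≢u (sym u≡v)))) u∈))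

⊆ᵇ-delete : ∀ {z} C W → z ∉ᵇ W → W ⊆ᵇ C → W ⊆ᵇ delete z C
⊆ᵇ-delete     C []      _  []          = []
⊆ᵇ-delete {z} C (a ∷ W) z∉ (a∈ ∷ W⊆) with z ℕ.≟ a
... | no z≢a = ∈ᵇ-filterᵇ _ C a∈ (cong not (⌊⌋-false (a ℕ.≟ z) (λ a≡z → z≢a (sym a≡z))))
             ∷ ⊆ᵇ-delete C W z∉ W⊆

length-≤-⊆ᵇ : ∀ W C → distinct W ≡ true → W ⊆ᵇ C → length W ≤ length C
length-≤-⊆ᵇ []      C _ _ = z≤n
length-≤-⊆ᵇ (z ∷ W) C d (z∈ ∷ W⊆) with ∧-≡true {not (memℕ z W)} d
... | z∉ , dW = ℕ.≤-trans (s≤s (length-≤-⊆ᵇ W (delete z C) dW (⊆ᵇ-delete C W (not-injective z∉) W⊆)))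
                          (length-delete< C z∈)

count-≡-⊆ᵇ : ∀ q W C → distinct W ≡ true → W ⊆ᵇ C → length W ≡ length C → count q W ≡ count q C
count-≡-⊆ᵇ q W C d W⊆C |W|≡|C| = ℕ.≤-antisym (≤-for q) (ℕ.+-cancelʳ-≤ (count q̅ C) _ _ ≥-sum)
  where
  q̅ = λ u → not (q u)
  ≤-for : ∀ p → count p W ≤ count p C
  ≤-for p = length-≤-⊆ᵇ (filterᵇ p W) (filterᵇ p C) (distinct-filterᵇ p W d) (⊆ᵇ-filterᵇ p C W⊆C)
  ≥-sum : count q C ℕ.+ count q̅ C ≤ count q W ℕ.+ count q̅ C
  ≥-sum = subst (_≤ count q W ℕ.+ count q̅ C)
                (trans (count+count-not q W) (trans |W|≡|C| (sym (count+count-not q C))))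
                (ℕ.+-monoʳ-≤ (count q W) (≤-for q̅))

delete-fresh : ∀ {u} L → All (_≢ u) L → delete u L ≡ L
delete-fresh     []      []          = refl
delete-fresh {u} (v ∷ L) (v≢u ∷ L≢u) rewrite ⌊⌋-false (v ℕ.≟ u) v≢u = cong (v ∷_) (delete-fresh L L≢u)

∉ᵇ-delete : ∀ u L → u ∉ᵇ delete u L
∉ᵇ-delete u []      = refl
∉ᵇ-delete u (v ∷ L) with v ℕ.≟ u
... | yes _  = ∉ᵇ-delete u L
... | no v≢u = trans (memℕ-there (delete u L) (λ u≡v → v≢u (sym u≡v))) (∉ᵇ-delete u L)

length-delete : ∀ {u} L → AllPairs _≢_ L → u ∈ᵇ L → suc (length (delete u L)) ≡ length L
length-delete {u} (v ∷ L) (v≢L ∷ L!) u∈ with v ℕ.≟ u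
... | yes refl = cong (λ L′ → suc (length L′)) (delete-fresh L (All.map (λ v≢w w≡v → v≢w (sym w≡v)) v≢L))
... | no v≢u   = cong suc (length-delete L L! (trans (sym (memℕ-there L (λ u≡v → v≢u (sym u≡v)))) u∈))

count-mono : ∀ {A : Set} {p q : A → Bool} → (∀ x → p x ≡ true → q x ≡ true) → ∀ xs → count p xs ≤ count q xs
count-mono         p⇒q []       = z≤n
count-mono {p = p} {q} p⇒q (x ∷ xs) with p x in px | q x in qx
... | true  | true  = s≤s (count-mono p⇒q xs)
... | true  | false with () ← trans (sym (p⇒q x px)) qx
... | false | true  = ℕ.m≤n⇒m≤1+n (count-mono p⇒q xs)
... | false | false = count-mono p⇒q xs

count-none : ∀ {A : Set} {p : A → Bool} xs → All (λ x → p x ≡ false) xs → count p xs ≡ 0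
count-none []       []           = refl
count-none (x ∷ xs) (px≡f ∷ pxs) rewrite px≡f = count-none xs pxs

count-mono-< : ∀ {p q : ℕ → Bool} → (∀ x → p x ≡ true → q x ≡ true) →
               ∀ {c} L → c ∈ᵇ L → p c ≡ false → q c ≡ true → count p L < count q L
count-mono-< {p} {q} p⇒q {c} (u ∷ L) c∈ pc qc with c ℕ.≟ u
... | yes refl rewrite pc | qc = s≤s (count-mono p⇒q L)
... | no _ with p u in pu | q u in qu
...   | true  | true  = s≤s (count-mono-< p⇒q L c∈ pc qc)
...   | true  | false with () ← trans (sym (p⇒q u pu)) qu
...   | false | true  = ℕ.m≤n⇒m≤1+n (count-mono-< p⇒q L c∈ pc qc)
...   | false | false = count-mono-< p⇒q L c∈ pc qc

rank : ℕ → List ℕ → ℕ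
rank v = count (λ u → ⌊ u <? v ⌋)

rank≤length : ∀ v L → rank v L ≤ length L
rank≤length v = length-filterᵇ _

rank-delete : ∀ u L → rank u (delete u L) ≡ rank u L
rank-delete u []      = refl
rank-delete u (v ∷ L) with v ℕ.≟ u
... | yes refl rewrite ⌊⌋-false (v <? v) (ℕ.<-irrefl refl) = rank-delete v L
... | no _ with ⌊ v <? u ⌋
...   | true  = cong suc (rank-delete u L)
...   | false = rank-delete u L

rank-mono : ∀ {v c} → v ≤ c → ∀ L → rank v L ≤ rank c L
rank-mono {v} {c} v≤c = count-mono λ u u<v → ⌊⌋-true (u <? c) (ℕ.<-≤-trans (⌊⌋≡true⇒ (u <? v) u<v) v≤c)

rank-<-∈ : ∀ {c v} L → c < v → c ∈ᵇ L → rank c L < rank v L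
rank-<-∈ {c} {v} L c<v c∈ = count-mono-< (λ u u<c → ⌊⌋-true (u <? v) (ℕ.<-trans (⌊⌋≡true⇒ (u <? c) u<c) c<v))
                                         L c∈ (⌊⌋-false (c <? c) (ℕ.<-irrefl refl)) (⌊⌋-true (c <? v) c<v)

<ᵇ≡rank≤ᵇ : ∀ {v c} L → v ∉ᵇ L → c ∈ᵇ L → ⌊ v <? c ⌋ ≡ ⌊ rank v L ≤? rank c L ⌋
<ᵇ≡rank≤ᵇ {v} {c} L v∉ c∈ with ℕ.<-cmp v c
... | tri< v<c _ _ = trans (⌊⌋-true (v <? c) v<c) (sym (⌊⌋-true (_ ≤? _) (rank-mono (ℕ.<⇒≤ v<c) L)))
... | tri≈ _ v≡c _ = contradiction v≡c (∉ᵇ-∈ᵇ⇒≢ L v∉ c∈)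
... | tri> v≮c _ c<v = trans (⌊⌋-false (v <? c) v≮c) (sym (⌊⌋-false (_ ≤? _) (ℕ.<⇒≱ (rank-<-∈ L c<v c∈))))

Σ-rank-sorted : ∀ (g : ℕ → ℤ) {L} → AllPairs _<_ L → Σ (λ c → g (rank c L)) L ≡ Σ g (upTo (length L))
Σ-rank-sorted g []                  = refl
Σ-rank-sorted g {c ∷ L} (c<L ∷ L<) = cong₂ _+_ (cong g rank-least) (begin
    Σ (λ c′ → g (rank c′ (c ∷ L))) L  ≡⟨ Σ-cong-All c<L (λ c<c′ → cong g (rank-∷-below c<c′)) ⟩
    Σ (λ c′ → g (suc (rank c′ L))) L  ≡⟨ Σ-rank-sorted (λ i → g (suc i)) L< ⟩
    Σ (λ i → g (suc i)) (upTo (length L)) ≡⟨ sym (Σ-map g suc (upTo (length L))) ⟩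
    Σ g (map suc (upTo (length L)))   ≡⟨ cong (Σ g) (List.map-applyUpTo (λ i → i) suc (length L)) ⟩
    Σ g (applyUpTo suc (length L))    ∎)
  where
  open ≡-Reasoning
  rank-least : rank c (c ∷ L) ≡ 0
  rank-least rewrite ⌊⌋-false (c <? c) (ℕ.<-irrefl refl) =
    count-none L (All.map (λ {u} c<u → ⌊⌋-false (u <? c) (ℕ.<-asym c<u)) c<L)
  rank-∷-below : ∀ {c′} → c < c′ → rank c′ (c ∷ L) ≡ suc (rank c′ L)
  rank-∷-below {c′} c<c′ rewrite ⌊⌋-true (c <? c′) c<c′ = refl

-- Inversions and alternation

pairInversions : ℤ → ℤ → ℕ
pairInversions x y = bit (y <ᵇ x) ℕ.+ bit (y <ᵇ - x)

-- y lies strictly between -∣x∣ and ∣x∣ exactly when one of y < x, y < -x holds;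
-- otherwise both or neither hold.
sign-pairInversions : ∀ x y → ∣ y ∣ ≢ ∣ x ∣ → sign (pairInversions x y) ≡ sign (bit ⌊ ∣ y ∣ <? ∣ x ∣ ⌋)
sign-pairInversions (+ zero) (+ b) _ with b <? 0
... | no _ = refl
sign-pairInversions (+ suc a) (+ b) _ with b <? suc a
... | yes _ = refl
... | no _  = refl
sign-pairInversions (+ zero) -[1+ b ] _ with suc b <? 0
... | no _ = refl
sign-pairInversions (+ suc a) -[1+ b ] y≢x with a <? b | suc b <? suc a
... | yes _   | no _    = refl
... | no _    | yes _   = refl
... | yes a<b | yes b<a = contradiction (ℕ.≤-pred b<a) (ℕ.<-asym a<b)
... | no a≮b  | no b≮a with ℕ.<-cmp a b
...   | tri< a<b _ _ = contradiction a<b a≮b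
...   | tri≈ _ a≡b _ = contradiction (cong suc (sym a≡b)) y≢x
...   | tri> _ _ b<a = contradiction (s≤s b<a) b≮a
sign-pairInversions -[1+ a ] (+ b) _ with b <? suc a
... | yes _ = refl
... | no _  = refl
sign-pairInversions -[1+ a ] -[1+ b ] y≢x with a <? b | suc b <? suc a
... | yes _   | no _    = refl
... | no _    | yes _   = refl
... | yes a<b | yes b<a = contradiction (ℕ.≤-pred b<a) (ℕ.<-asym a<b)
... | no a≮b  | no b≮a with ℕ.<-cmp a b
...   | tri< a<b _ _ = contradiction a<b a≮b
...   | tri≈ _ a≡b _ = contradiction (cong suc (sym a≡b)) y≢x
...   | tri> _ _ b<a = contradiction (s≤s b<a) b≮a

sign-invFrom : ∀ x w → ∣ x ∣ ∉ᵇ map ∣_∣ w → sign (invFrom x w) ≡ sign (rank ∣ x ∣ (map ∣_∣ w))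
sign-invFrom x []      _  = refl
sign-invFrom x (y ∷ w) x∉ with ∣ x ∣ ℕ.≟ ∣ y ∣
... | no x≢y = begin
  sign (pairInversions x y ℕ.+ invFrom x w)                  ≡⟨ sign-+ (pairInversions x y) (invFrom x w) ⟩
  sign (pairInversions x y) * sign (invFrom x w)             ≡⟨ cong₂ _*_ (sign-pairInversions x y (λ y≡x → x≢y (sym y≡x)))
                                                                          (sign-invFrom x w x∉) ⟩
  sign (bit ⌊ ∣ y ∣ <? ∣ x ∣ ⌋) * sign (rank ∣ x ∣ (map ∣_∣ w)) ≡⟨ sym (sign-+ (bit ⌊ ∣ y ∣ <? ∣ x ∣ ⌋) _) ⟩
  sign (bit ⌊ ∣ y ∣ <? ∣ x ∣ ⌋ ℕ.+ rank ∣ x ∣ (map ∣_∣ w))     ≡⟨ cong sign (sym (count-∷ (λ u → ⌊ u <? ∣ x ∣ ⌋) ∣ y ∣ (map ∣_∣ w))) ⟩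
  sign (rank ∣ x ∣ (map ∣_∣ (y ∷ w)))                         ∎
  where open ≡-Reasoning

alternates : Bool → ℤ → ℤ → Bool
alternates d x y = if d then y <ᵇ x else x <ᵇ y

nonNeg : ℤ → Bool
nonNeg (+ _)      = true
nonNeg -[1+ _ ]   = false

-- alternates d x (± c) as a function of b = [∣ x ∣ < c], the sign of ± c and that of x.
alternatesᵃ : Bool → Bool → Bool → Bool → Bool
alternatesᵃ true  s sx d = if d then not s else s
alternatesᵃ false s sx d = if d then sx else not sx

alternates-+ : ∀ d x j → ∣ x ∣ ≢ suc j →
               alternates d x (+ suc j) ≡ alternatesᵃ ⌊ ∣ x ∣ <? suc j ⌋ true (nonNeg x) d
alternates-+ true (+ a) j x≢j with suc j <? a | a <? suc j
... | yes _   | no _    = refl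
... | no _    | yes _   = refl
... | yes j<a | yes a<j = contradiction a<j (ℕ.<-asym j<a)
... | no j≮a  | no a≮j with ℕ.<-cmp a (suc j)
...   | tri< a<j _ _ = contradiction a<j a≮j
...   | tri≈ _ a≡j _ = contradiction a≡j x≢j
...   | tri> _ _ j<a = contradiction j<a j≮a
alternates-+ true -[1+ a ] j _ with suc a <? suc j
... | yes _ = refl
... | no _  = refl
alternates-+ false (+ a) j _ with a <? suc j
... | yes _ = refl
... | no _  = refl
alternates-+ false -[1+ a ] j _ with suc a <? suc j
... | yes _ = refl
... | no _  = refl

alternates-- : ∀ d x j → ∣ x ∣ ≢ suc j →
               alternates d x -[1+ j ] ≡ alternatesᵃ ⌊ ∣ x ∣ <? suc j ⌋ false (nonNeg x) d
alternates-- true (+ a) j _ with a <? suc j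
... | yes _ = refl
... | no _  = refl
alternates-- true -[1+ a ] j _ with a <? j | suc a <? suc j
... | yes _   | yes _   = refl
... | no _    | no _    = refl
... | yes a<j | no a≮j  = contradiction (s≤s a<j) a≮j
... | no a≮j  | yes a<j = contradiction (ℕ.≤-pred a<j) a≮j
alternates-- false (+ a) j _ with a <? suc j
... | yes _ = refl
... | no _  = refl
alternates-- false -[1+ a ] j x≢j with j <? a | suc a <? suc j
... | yes _   | no _    = refl
... | no _    | yes _   = refl
... | yes j<a | yes a<j = contradiction (ℕ.≤-pred a<j) (ℕ.<-asym j<a)
... | no j≮a  | no a≮j with ℕ.<-cmp a j
...   | tri< a<j _ _ = contradiction (s≤s a<j) a≮j
...   | tri≈ _ a≡j _ = contradiction (cong suc a≡j) x≢j
...   | tri> _ _ j<a = contradiction j<a j≮a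

twist : Bool → List ℤ → ℤ
twist t w = if t then sign (negCount w) else + 1

twistᵇ : Bool → Bool → ℤ
twistᵇ t s = if t then signᵇ s else + 1

twist-∷ : ∀ t y w → twist t (y ∷ w) ≡ twistᵇ t (nonNeg y) * twist t w
twist-∷ false y w = refl
twist-∷ true  y w = trans (sign-+ (bit (y <ᵇ + 0)) (negCount w)) (cong (_* sign (negCount w)) (sign-negative y))
  where
  sign-negative : ∀ y → sign (bit (y <ᵇ + 0)) ≡ signᵇ (nonNeg y)
  sign-negative (+ n)    rewrite ⌊⌋-false (+ n ℤ.<? + 0) (λ { (ℤ.+<+ ()) }) = refl
  sign-negative -[1+ n ] = refl

-- Unused values and weighted words

values : ℕ → List ℕ
values n = map suc (upTo n)

unused : ℕ → List ℕ → List ℕ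
unused n P = filterᵇ (λ v → not (memℕ v P)) (values n)

unused-sorted : ∀ n P → AllPairs _<_ (unused n P)
unused-sorted n P rewrite filterᵇ≡filter (λ v → not (memℕ v P)) (values n) =
  AllPairs.filter⁺ _ (AllPairs.map⁺ (AllPairs.applyUpTo⁺₁ (λ i → i) n (λ i<j _ → s≤s i<j)))

unused-∷ : ∀ n u P → unused n (u ∷ P) ≡ delete u (unused n P)
unused-∷ n u P = go (values n)
  where
  go : ∀ L → filterᵇ (λ v → not (memℕ v (u ∷ P))) L ≡ delete u (filterᵇ (λ v → not (memℕ v P)) L)
  go []      = refl
  go (v ∷ L) with v ℕ.≟ u | memℕ v P
  ... | yes refl | true  = go L
  ... | yes refl | false rewrite ⌊⌋-true (v ℕ.≟ v) refl = go L
  ... | no _     | true  = go L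
  ... | no v≢u   | false rewrite ⌊⌋-false (v ℕ.≟ u) v≢u = cong (v ∷_) (go L)

rank-unused-∷ : ∀ n u P → rank u (unused n (u ∷ P)) ≡ rank u (unused n P)
rank-unused-∷ n u P = trans (cong (rank u) (unused-∷ n u P)) (rank-delete u (unused n P))

∉ᵇ-unused-∷ : ∀ n u P → u ∉ᵇ unused n (u ∷ P)
∉ᵇ-unused-∷ n u P = trans (cong (memℕ u) (unused-∷ n u P)) (∉ᵇ-delete u (unused n P))

length-unused-∷ : ∀ n {u} P → u ∈ᵇ values n → u ∉ᵇ P → suc (length (unused n (u ∷ P))) ≡ length (unused n P)
length-unused-∷ n {u} P u∈ u∉ = trans (cong (λ L → suc (length L)) (unused-∷ n u P))
  (length-delete (unused n P) (AllPairs.map ℕ.<⇒≢ (unused-sorted n P)) (∈ᵇ-filterᵇ _ (values n) u∈ (cong not u∉)))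

length-unused-[] : ∀ n → length (unused n []) ≡ n
length-unused-[] n = trans (cong length (filterᵇ-true (values n)))
                           (trans (List.length-map suc (upTo n)) (List.length-applyUpTo (λ i → i) n))
  where
  filterᵇ-true : ∀ L → filterᵇ (λ _ → true) L ≡ L
  filterᵇ-true []      = refl
  filterᵇ-true (v ∷ L) = cong (v ∷_) (filterᵇ-true L)

0∉ᵇunused : ∀ n P → 0 ∉ᵇ unused n P
0∉ᵇunused n P = ∉ᵇ-filterᵇ _ (values n) (0∉ᵇmap-suc (upTo n))
  where
  0∉ᵇmap-suc : ∀ L → 0 ∉ᵇ map suc L
  0∉ᵇmap-suc []      = refl
  0∉ᵇmap-suc (_ ∷ L) = 0∉ᵇmap-suc L

rank-zero : ∀ L → rank 0 L ≡ 0
rank-zero []      = refl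
rank-zero (_ ∷ L) = rank-zero L

avoids : List ℕ → List ℤ → Bool
avoids P w = all (λ v → not (memℕ v P)) (map ∣_∣ w)

avoids-∷ : ∀ u P w → avoids (u ∷ P) w ≡ not (memℕ u (map ∣_∣ w)) ∧ avoids P w
avoids-∷ u P []      = refl
avoids-∷ u P (z ∷ w) with ∣ z ∣ ℕ.≟ u | u ℕ.≟ ∣ z ∣
... | yes _   | yes _   = refl
... | yes z≡u | no u≢z  = ⊥-elim (u≢z (sym z≡u))
... | no z≢u  | yes u≡z = ⊥-elim (z≢u (sym u≡z))
... | no _    | no _ rewrite avoids-∷ u P w with memℕ ∣ z ∣ P
...   | true  = sym (∧-zeroʳ _)
...   | false = refl

avoids⇒⊆ᵇunused : ∀ n Q w → avoids Q w ≡ true → All (λ z → ∣ z ∣ ∈ᵇ values n) w → map ∣_∣ w ⊆ᵇ unused n Q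
avoids⇒⊆ᵇunused n Q []      _  []         = []
avoids⇒⊆ᵇunused n Q (z ∷ w) av (z∈ ∷ w∈) with ∧-≡true {not (memℕ ∣ z ∣ Q)} av
... | z∉ , av′ = ∈ᵇ-filterᵇ _ (values n) z∈ z∉ ∷ avoids⇒⊆ᵇunused n Q w av′ w∈

IsWord : ℕ → ℕ → List ℤ → Set
IsWord n k w = length w ≡ k × All (λ z → ∣ z ∣ ∈ᵇ values n) w

entries-∈ : ∀ n → All (λ y → ∣ y ∣ ∈ᵇ values n) (entries n)
entries-∈ n = All.++⁺ (All.map⁺ suc∈) (All.map⁺ suc∈)
  where
  suc∈ : All (λ j → suc j ∈ᵇ values n) (upTo n)
  suc∈ = All.map⁻ (⊆ᵇ-refl (values n))

words-IsWord : ∀ n k → All (IsWord n k) (words n k)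
words-IsWord n zero    = (refl , []) ∷ []
words-IsWord n (suc k) = All.concat⁺ (All.map⁺ (All.map extend (entries-∈ n)))
  where
  extend : ∀ {y} → ∣ y ∣ ∈ᵇ values n → All (IsWord n (suc k)) (map (y ∷_) (words n k))
  extend y∈ = All.map⁺ (All.map (λ (|w|≡k , w∈) → cong suc |w|≡k , y∈ ∷ w∈) (words-IsWord n k))

-- weight t P x d w is the signed contribution of w as the continuation of a signed
-- permutation whose last letter is x and whose letters so far have absolute values P;
-- d says whether w must start with a descent, and t whether to twist by (-1)^neg.
weight : Bool → List ℕ → ℤ → Bool → List ℤ → ℤ
weight t P x d w = 𝟙 (distinct (map ∣_∣ w) ∧ avoids P w ∧ alt d (x ∷ w)) * (twist t w * sign (invD w))

tailSum : Bool → ℕ → ℕ → List ℕ → ℤ → Bool → ℤ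
tailSum t n k P x d = Σ (weight t P x d) (words n k)

stepFactor : Bool → ℕ → List ℕ → Bool → ℤ → ℤ → ℤ
stepFactor t n P d x y =
  𝟙 (not (memℕ ∣ y ∣ P)) * (𝟙 (alternates d x y) * (twistᵇ t (nonNeg y) * sign (rank ∣ y ∣ (unused n P))))

rank-word≡rank-unused : ∀ n k u P w → IsWord n k w → length (unused n (u ∷ P)) ≡ k →
  distinct (map ∣_∣ w) ≡ true → avoids (u ∷ P) w ≡ true → rank u (map ∣_∣ w) ≡ rank u (unused n P)
rank-word≡rank-unused n k u P w (|w|≡k , w∈) |U|≡k dw av = begin
  rank u (map ∣_∣ w)             ≡⟨ count-≡-⊆ᵇ _ (map ∣_∣ w) (unused n (u ∷ P)) dw (avoids⇒⊆ᵇunused n (u ∷ P) w av w∈)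
                                               (trans (List.length-map ∣_∣ w) (trans |w|≡k (sym |U|≡k))) ⟩
  rank u (unused n (u ∷ P))      ≡⟨ rank-unused-∷ n u P ⟩
  rank u (unused n P)            ∎
  where open ≡-Reasoning

weight-∷ : ∀ t n k P x d y w → IsWord n k w → ∣ y ∣ ∈ᵇ values n → length (unused n P) ≡ suc k →
           weight t P x d (y ∷ w) ≡ stepFactor t n P d x y * weight t (∣ y ∣ ∷ P) y (not d) w
weight-∷ t n k P x d y w w-ok y∈ |U|≡1+k = begin
  𝟙 G * (twist t (y ∷ w) * sign (invFrom y w ℕ.+ invD w))
    ≡⟨ cong (λ b → 𝟙 b * (twist t (y ∷ w) * sign (invFrom y w ℕ.+ invD w))) G≡ ⟩
  𝟙 ((p̅ ∧ c) ∧ G′) * (twist t (y ∷ w) * sign (invFrom y w ℕ.+ invD w))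
    ≡⟨ 𝟙*-cong ((p̅ ∧ c) ∧ G′) (λ g → cong₂ _*_ (twist-∷ t y w) (sign-factor g)) ⟩
  𝟙 ((p̅ ∧ c) ∧ G′) * ((τ * twist t w) * (σ * sign (invD w)))
    ≡⟨ cong (_* ((τ * twist t w) * (σ * sign (invD w)))) (trans (𝟙-∧ (p̅ ∧ c) G′) (cong (_* 𝟙 G′) (𝟙-∧ p̅ c))) ⟩
  𝟙 p̅ * 𝟙 c * 𝟙 G′ * ((τ * twist t w) * (σ * sign (invD w)))
    ≡⟨ regroup (𝟙 p̅) (𝟙 c) (𝟙 G′) τ (twist t w) σ (sign (invD w)) ⟩
  stepFactor t n P d x y * weight t (∣ y ∣ ∷ P) y (not d) w ∎
  where
  open ≡-Reasoning
  u = ∣ y ∣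
  p̅ = not (memℕ u P)
  c = alternates d x y
  τ = twistᵇ t (nonNeg y)
  σ = sign (rank u (unused n P))
  G = distinct (map ∣_∣ (y ∷ w)) ∧ avoids P (y ∷ w) ∧ alt d (x ∷ y ∷ w)
  G′ = distinct (map ∣_∣ w) ∧ avoids (u ∷ P) w ∧ alt (not d) (y ∷ w)
  G≡ : G ≡ (p̅ ∧ c) ∧ G′
  G≡ = trans (solve 6 (λ m D p A c R → (m ⊕ D) ⊕ (p ⊕ A) ⊕ (c ⊕ R) ⊜ (p ⊕ c) ⊕ (D ⊕ (m ⊕ A) ⊕ R)) refl
               (not (memℕ u (map ∣_∣ w))) (distinct (map ∣_∣ w)) p̅ (avoids P w) c (alt (not d) (y ∷ w)))
             (cong (λ a → (p̅ ∧ c) ∧ (distinct (map ∣_∣ w) ∧ a ∧ alt (not d) (y ∷ w))) (sym (avoids-∷ u P w)))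
  sign-factor : (p̅ ∧ c) ∧ G′ ≡ true → sign (invFrom y w ℕ.+ invD w) ≡ σ * sign (invD w)
  sign-factor g = trans (sign-+ (invFrom y w) (invD w)) (cong (_* sign (invD w)) (trans
      (sign-invFrom y w (not-injective (proj₁ (∧-≡true {not (memℕ u (map ∣_∣ w))} (trans (sym (avoids-∷ u P w)) av)))))
      (cong sign (rank-word≡rank-unused n k u P w w-ok |U′|≡k dw av))))
    where
    g₁ = ∧-≡true {p̅ ∧ c} g
    g₂ = ∧-≡true {distinct (map ∣_∣ w)} (proj₂ g₁)
    dw = proj₁ g₂
    av = proj₁ (∧-≡true {avoids (u ∷ P) w} (proj₂ g₂))
    |U′|≡k = ℕ.suc-injective (trans (length-unused-∷ n P y∈ (not-injective (proj₁ (∧-≡true {p̅} (proj₁ g₁))))) |U|≡1+k)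
  regroup : ∀ a b g τ tw s iw → a * b * g * ((τ * tw) * (s * iw)) ≡ (a * (b * (τ * s))) * (g * (tw * iw))
  regroup = solve-∀

tailSum-suc : ∀ t n k P x d → length (unused n P) ≡ suc k →
  tailSum t n (suc k) P x d ≡ Σ (λ y → stepFactor t n P d x y * tailSum t n k (∣ y ∣ ∷ P) y (not d)) (entries n)
tailSum-suc t n k P x d |U|≡1+k = begin
  Σ (weight t P x d) (concatMap (λ y → map (y ∷_) (words n k)) (entries n))
    ≡⟨ Σ-concatMap (weight t P x d) (λ y → map (y ∷_) (words n k)) (entries n) ⟩
  Σ (λ y → Σ (weight t P x d) (map (y ∷_) (words n k))) (entries n)
    ≡⟨ Σ-cong (entries n) (λ y → Σ-map (weight t P x d) (y ∷_) (words n k)) ⟩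
  Σ (λ y → Σ (λ w → weight t P x d (y ∷ w)) (words n k)) (entries n)
    ≡⟨ Σ-cong-All (entries-∈ n) (λ {y} y∈ → trans
         (Σ-cong-All (words-IsWord n k) (λ {w} w-ok → weight-∷ t n k P x d y w w-ok y∈ |U|≡1+k))
         (Σ-*ˡ (stepFactor t n P d x y) _ (words n k))) ⟩
  Σ (λ y → stepFactor t n P d x y * tailSum t n k (∣ y ∣ ∷ P) y (not d)) (entries n) ∎
  where open ≡-Reasoning

-- The closed form

-- ε k = (-1)^⌊k/2⌋
ε : ℕ → ℤ
ε 0 = + 1
ε 1 = + 1
ε 2 = - + 1
ε 3 = - + 1
ε (suc (suc (suc (suc k)))) = ε k

ε-suc-suc : ∀ n → ε (suc (suc n)) ≡ - ε n
ε-suc-suc 0 = refl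
ε-suc-suc 1 = refl
ε-suc-suc 2 = refl
ε-suc-suc 3 = refl
ε-suc-suc (suc (suc (suc (suc n)))) = ε-suc-suc n

%4-suc⁴ : ∀ n → suc (suc (suc (suc n))) % 4 ≡ n % 4
%4-suc⁴ n = trans (cong (_% 4) (ℕ.+-comm 4 n)) ([m+n]%n≡m%n n 4)

ε≡1 : ∀ n → n % 4 ≡ 0 ⊎ n % 4 ≡ 1 → ε n ≡ + 1
ε≡1 0 _ = refl
ε≡1 1 _ = refl
ε≡1 2 (inj₁ ())
ε≡1 2 (inj₂ ())
ε≡1 3 (inj₁ ())
ε≡1 3 (inj₂ ())
ε≡1 (suc (suc (suc (suc n)))) n%4 = ε≡1 n (subst (λ r → r ≡ 0 ⊎ r ≡ 1) (%4-suc⁴ n) n%4)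

ε≡-1 : ∀ n → n % 4 ≡ 2 ⊎ n % 4 ≡ 3 → ε n ≡ - + 1
ε≡-1 0 (inj₁ ())
ε≡-1 0 (inj₂ ())
ε≡-1 1 (inj₁ ())
ε≡-1 1 (inj₂ ())
ε≡-1 2 _ = refl
ε≡-1 3 _ = refl
ε≡-1 (suc (suc (suc (suc n)))) n%4 = ε≡-1 n (subst (λ r → r ≡ 2 ⊎ r ≡ 3) (%4-suc⁴ n) n%4)

-- The value of tailSum t n k P x d when ∣ x ∣ has rank r among the k unused values
-- and s is the sign of x.
value : Bool → Bool → ℕ → ℕ → Bool → ℤ
value t d k r s = table t d r s (ε k) (ε (suc k))
  where
  table : Bool → Bool → ℕ → Bool → ℤ → ℤ → ℤ
  table t     d     (suc (suc r)) s     a b = + 0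
  table true  true  0             s     a b = b
  table true  false 0             s     a b = a
  table false d     0             s     a b = a
  table true  d     1             s     a b = + 0
  table false true  1             true  a b = a - b
  table false true  1             false a b = a + b
  table false false 1             true  a b = a + b
  table false false 1             false a b = a - b

-- The contribution of the unused value c of rank i, entered as + c and as - c,
-- where b = [∣ x ∣ < c].
branch : Bool → Bool → ℕ → Bool → Bool → ℕ → ℤ
branch t d k sx b i = Σ (λ s → 𝟙 (alternatesᵃ b s sx d) * (twistᵇ t s * sign i) * value t (not d) k i s) (true ∷ false ∷ [])

branch-rank≥2 : ∀ t d k sx b i → branch t d k sx b (suc (suc i)) ≡ + 0
branch-rank≥2 t d k sx b i
  rewrite ℤ.*-zeroʳ (𝟙 (alternatesᵃ b true sx d) * (twistᵇ t true * sign i))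
        | ℤ.*-zeroʳ (𝟙 (alternatesᵃ b false sx d) * (twistᵇ t false * sign i)) = refl

by-rank : {P : ℕ → Set} → P 0 → P 1 → (∀ r → P (suc (suc r))) → ∀ r → P r
by-rank p₀ p₁ p₂₊ zero          = p₀
by-rank p₀ p₁ p₂₊ (suc zero)    = p₁
by-rank p₀ p₁ p₂₊ (suc (suc r)) = p₂₊ r

value-one : ∀ t d s → value t d 1 0 s ≡ branch t d 0 s true 0 + + 0 × value t d 1 1 s ≡ branch t d 0 s false 0 + + 0
value-one true  true  true  = refl , refl
value-one true  true  false = refl , refl
value-one true  false true  = refl , refl
value-one true  false false = refl , refl
value-one false true  true  = refl , refl
value-one false true  false = refl , refl
value-one false false true  = refl , refl
value-one false false false = refl , refl

-- A finite check: value depends on k only through ε, which is 4-periodic.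
value-suc-suc : ∀ t d k s r →
  value t d (suc (suc k)) r s ≡ branch t d (suc k) s ⌊ r ≤? 0 ⌋ 0 + (branch t d (suc k) s ⌊ r ≤? 1 ⌋ 1 + + 0)
value-suc-suc true  true  0 true  = by-rank refl refl λ _ → refl
value-suc-suc true  true  0 false = by-rank refl refl λ _ → refl
value-suc-suc true  false 0 true  = by-rank refl refl λ _ → refl
value-suc-suc true  false 0 false = by-rank refl refl λ _ → refl
value-suc-suc false true  0 true  = by-rank refl refl λ _ → refl
value-suc-suc false true  0 false = by-rank refl refl λ _ → refl
value-suc-suc false false 0 true  = by-rank refl refl λ _ → refl
value-suc-suc false false 0 false = by-rank refl refl λ _ → refl
value-suc-suc true  true  1 true  = by-rank refl refl λ _ → refl
value-suc-suc true  true  1 false = by-rank refl refl λ _ → refl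
value-suc-suc true  false 1 true  = by-rank refl refl λ _ → refl
value-suc-suc true  false 1 false = by-rank refl refl λ _ → refl
value-suc-suc false true  1 true  = by-rank refl refl λ _ → refl
value-suc-suc false true  1 false = by-rank refl refl λ _ → refl
value-suc-suc false false 1 true  = by-rank refl refl λ _ → refl
value-suc-suc false false 1 false = by-rank refl refl λ _ → refl
value-suc-suc true  true  2 true  = by-rank refl refl λ _ → refl
value-suc-suc true  true  2 false = by-rank refl refl λ _ → refl
value-suc-suc true  false 2 true  = by-rank refl refl λ _ → refl
value-suc-suc true  false 2 false = by-rank refl refl λ _ → refl
value-suc-suc false true  2 true  = by-rank refl refl λ _ → refl
value-suc-suc false true  2 false = by-rank refl refl λ _ → refl
value-suc-suc false false 2 true  = by-rank refl refl λ _ → refl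
value-suc-suc false false 2 false = by-rank refl refl λ _ → refl
value-suc-suc true  true  3 true  = by-rank refl refl λ _ → refl
value-suc-suc true  true  3 false = by-rank refl refl λ _ → refl
value-suc-suc true  false 3 true  = by-rank refl refl λ _ → refl
value-suc-suc true  false 3 false = by-rank refl refl λ _ → refl
value-suc-suc false true  3 true  = by-rank refl refl λ _ → refl
value-suc-suc false true  3 false = by-rank refl refl λ _ → refl
value-suc-suc false false 3 true  = by-rank refl refl λ _ → refl
value-suc-suc false false 3 false = by-rank refl refl λ _ → refl
value-suc-suc t d (suc (suc (suc (suc k)))) s = value-suc-suc t d k s

value-suc : ∀ t d k s r → r ≤ suc k → value t d (suc k) r s ≡ Σ (λ i → branch t d k s ⌊ r ≤? i ⌋ i) (upTo (suc k))
value-suc t d zero    s zero          _                 = proj₁ (value-one t d s)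
value-suc t d zero    s (suc zero)    _                 = proj₂ (value-one t d s)
value-suc t d zero    s (suc (suc r)) (s≤s ())
value-suc t d (suc k) s r             _                 = trans (value-suc-suc t d k s r)
  (cong (λ z → branch t d (suc k) s ⌊ r ≤? 0 ⌋ 0 + (branch t d (suc k) s ⌊ r ≤? 1 ⌋ 1 + z))
        (sym (Σ-zero (applyUpTo (λ i → suc (suc i)) k)
                     (All.applyUpTo⁺₂ _ k (λ i → branch-rank≥2 t d (suc k) s ⌊ r ≤? suc (suc i) ⌋ i)))))

Σ-branch : ∀ t d k s v L → AllPairs _<_ L → length L ≡ suc k → v ∉ᵇ L →
  Σ (λ c → branch t d k s ⌊ v <? c ⌋ (rank c L)) L ≡ value t d (suc k) (rank v L) s
Σ-branch t d k s v L sorted |L|≡1+k v∉ = begin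
  Σ (λ c → branch t d k s ⌊ v <? c ⌋ (rank c L)) L
    ≡⟨ Σ-cong-All (⊆ᵇ-refl L) (λ {c} c∈ → cong (λ b → branch t d k s b (rank c L)) (<ᵇ≡rank≤ᵇ L v∉ c∈)) ⟩
  Σ (λ c → branch t d k s ⌊ rank v L ≤? rank c L ⌋ (rank c L)) L
    ≡⟨ Σ-rank-sorted (λ i → branch t d k s ⌊ rank v L ≤? i ⌋ i) sorted ⟩
  Σ (λ i → branch t d k s ⌊ rank v L ≤? i ⌋ i) (upTo (length L))
    ≡⟨ cong (λ m → Σ (λ i → branch t d k s ⌊ rank v L ≤? i ⌋ i) (upTo m)) |L|≡1+k ⟩
  Σ (λ i → branch t d k s ⌊ rank v L ≤? i ⌋ i) (upTo (suc k))
    ≡⟨ sym (value-suc t d k s (rank v L) (subst (rank v L ≤_) |L|≡1+k (rank≤length v L))) ⟩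
  value t d (suc k) (rank v L) s ∎
  where open ≡-Reasoning

Σ-entries : ∀ (h : ℤ → ℤ) n → Σ h (entries n) ≡ Σ (λ j → h (+ suc j) + h -[1+ j ]) (upTo n)
Σ-entries h n = begin
  Σ h (map (λ j → + suc j) (upTo n) ++ map (λ j → -[1+ j ]) (upTo n))
    ≡⟨ Σ-++ h (map (λ j → + suc j) (upTo n)) (map (λ j → -[1+ j ]) (upTo n)) ⟩
  Σ h (map (λ j → + suc j) (upTo n)) + Σ h (map (λ j → -[1+ j ]) (upTo n))
    ≡⟨ cong₂ _+_ (Σ-map h (λ j → + suc j) (upTo n)) (Σ-map h (λ j → -[1+ j ]) (upTo n)) ⟩
  Σ (λ j → h (+ suc j)) (upTo n) + Σ (λ j → h -[1+ j ]) (upTo n)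
    ≡⟨ sym (Σ-+ (λ j → h (+ suc j)) (λ j → h -[1+ j ]) (upTo n)) ⟩
  Σ (λ j → h (+ suc j) + h -[1+ j ]) (upTo n) ∎
  where open ≡-Reasoning

stepFactor*-cong : ∀ t n P d x y {a b} → (∣ y ∣ ∉ᵇ P → a ≡ b) → stepFactor t n P d x y * a ≡ stepFactor t n P d x y * b
stepFactor*-cong t n P d x y {a} {b} a≡b = begin
  𝟙 p̅ * X * a   ≡⟨ ℤ.*-assoc (𝟙 p̅) X a ⟩
  𝟙 p̅ * (X * a) ≡⟨ 𝟙*-cong p̅ (λ p̅≡true → cong (X *_) (a≡b (not-injective p̅≡true))) ⟩
  𝟙 p̅ * (X * b) ≡⟨ ℤ.*-assoc (𝟙 p̅) X b ⟨
  𝟙 p̅ * X * b   ∎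
  where
  open ≡-Reasoning
  p̅ = not (memℕ ∣ y ∣ P)
  X = 𝟙 (alternates d x y) * (twistᵇ t (nonNeg y) * sign (rank ∣ y ∣ (unused n P)))

stepFactor-± : ∀ t n P d x k j → ∣ x ∣ ∉ᵇ unused n P → suc j ∈ᵇ values n →
  let r = rank (suc j) (unused n P) in
  stepFactor t n P d x (+ suc j) * value t (not d) k r true + stepFactor t n P d x -[1+ j ] * value t (not d) k r false
    ≡ 𝟙 (not (memℕ (suc j) P)) * branch t d k (nonNeg x) ⌊ ∣ x ∣ <? suc j ⌋ r
stepFactor-± t n P d x k j x∉ j∈ = begin
  𝟙 p̅ * X true (+ suc j) * V true + 𝟙 p̅ * X false -[1+ j ] * V false
    ≡⟨ cong₂ _+_ (ℤ.*-assoc (𝟙 p̅) _ _) (ℤ.*-assoc (𝟙 p̅) _ _) ⟩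
  𝟙 p̅ * (X true (+ suc j) * V true) + 𝟙 p̅ * (X false -[1+ j ] * V false)
    ≡⟨ ℤ.*-distribˡ-+ (𝟙 p̅) _ _ ⟨
  𝟙 p̅ * (X true (+ suc j) * V true + X false -[1+ j ] * V false)
    ≡⟨ 𝟙*-cong p̅ (λ p̅≡true → cong₂ _+_
         (cong (λ a → 𝟙 a * (twistᵇ t true * sign r) * V true) (alternates-+ d x j (x≢j p̅≡true)))
         (trans (cong (λ a → 𝟙 a * (twistᵇ t false * sign r) * V false) (alternates-- d x j (x≢j p̅≡true)))
                (sym (ℤ.+-identityʳ _)))) ⟩
  𝟙 p̅ * branch t d k (nonNeg x) ⌊ ∣ x ∣ <? suc j ⌋ r ∎
  where
  open ≡-Reasoning
  p̅ = not (memℕ (suc j) P)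
  r = rank (suc j) (unused n P)
  X : Bool → ℤ → ℤ
  X s y = 𝟙 (alternates d x y) * (twistᵇ t s * sign r)
  V : Bool → ℤ
  V = value t (not d) k r
  x≢j : p̅ ≡ true → ∣ x ∣ ≢ suc j
  x≢j p̅≡true = ∉ᵇ-∈ᵇ⇒≢ (unused n P) x∉ (∈ᵇ-filterᵇ _ (values n) j∈ p̅≡true)

tailSum≡value : ∀ t n k P x d → ∣ x ∣ ∉ᵇ unused n P → length (unused n P) ≡ k →
  tailSum t n k P x d ≡ value t d k (rank ∣ x ∣ (unused n P)) (nonNeg x)
tailSum≡value t n zero P x d _ |U|≡0 with unused n P | |U|≡0
... | [] | refl = last-letter t d
  where
  last-letter : ∀ t d → weight t P x d [] + + 0 ≡ value t d 0 0 (nonNeg x)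
  last-letter true  true  = refl
  last-letter true  false = refl
  last-letter false true  = refl
  last-letter false false = refl
tailSum≡value t n (suc k) P x d x∉ |U|≡1+k = begin
  tailSum t n (suc k) P x d
    ≡⟨ tailSum-suc t n k P x d |U|≡1+k ⟩
  Σ (λ y → stepFactor t n P d x y * tailSum t n k (∣ y ∣ ∷ P) y (not d)) (entries n)
    ≡⟨ Σ-cong-All (entries-∈ n) (λ {y} y∈ → stepFactor*-cong t n P d x y (induction y y∈)) ⟩
  Σ h (entries n)
    ≡⟨ Σ-entries h n ⟩
  Σ (λ j → h (+ suc j) + h -[1+ j ]) (upTo n)
    ≡⟨ Σ-cong-All (All.map⁻ (⊆ᵇ-refl (values n))) (λ {j} j∈ → stepFactor-± t n P d x k j x∉ j∈) ⟩
  Σ (λ j → 𝟙 (not (memℕ (suc j) P)) * B (suc j)) (upTo n)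
    ≡⟨ Σ-map (λ c → 𝟙 (not (memℕ c P)) * B c) suc (upTo n) ⟨
  Σ (λ c → 𝟙 (not (memℕ c P)) * B c) (values n)
    ≡⟨ Σ-filterᵇ (λ c → not (memℕ c P)) B (values n) ⟨
  Σ B (unused n P)
    ≡⟨ Σ-branch t d k (nonNeg x) ∣ x ∣ (unused n P) (unused-sorted n P) |U|≡1+k x∉ ⟩
  value t d (suc k) (rank ∣ x ∣ (unused n P)) (nonNeg x) ∎
  where
  open ≡-Reasoning
  h : ℤ → ℤ
  h y = stepFactor t n P d x y * value t (not d) k (rank ∣ y ∣ (unused n P)) (nonNeg y)
  B : ℕ → ℤ
  B c = branch t d k (nonNeg x) ⌊ ∣ x ∣ <? c ⌋ (rank c (unused n P))
  induction : ∀ y → ∣ y ∣ ∈ᵇ values n → ∣ y ∣ ∉ᵇ P →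
    tailSum t n k (∣ y ∣ ∷ P) y (not d) ≡ value t (not d) k (rank ∣ y ∣ (unused n P)) (nonNeg y)
  induction y y∈ y∉ = begin
    tailSum t n k (∣ y ∣ ∷ P) y (not d)
      ≡⟨ tailSum≡value t n k (∣ y ∣ ∷ P) y (not d) (∉ᵇ-unused-∷ n ∣ y ∣ P)
           (ℕ.suc-injective (trans (length-unused-∷ n P y∈ y∉) |U|≡1+k)) ⟩
    value t (not d) k (rank ∣ y ∣ (unused n (∣ y ∣ ∷ P))) (nonNeg y)
      ≡⟨ cong (λ r → value t (not d) k r (nonNeg y)) (rank-unused-∷ n ∣ y ∣ P) ⟩
    value t (not d) k (rank ∣ y ∣ (unused n P)) (nonNeg y) ∎

-- With the virtual first letter 0 and a first ascent, alt is exactly isSnake.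
snakeSum : ∀ t n → tailSum t n n [] (+ 0) false ≡ ε n
snakeSum t n = trans (tailSum≡value t n n [] (+ 0) false (0∉ᵇunused n []) (length-unused-[] n))
                     (trans (cong (λ r → value t false n r true) (rank-zero (unused n []))) (value-rank0 t))
  where
  value-rank0 : ∀ t → value t false n 0 true ≡ ε n
  value-rank0 true  = refl
  value-rank0 false = refl

avoids-[] : ∀ w → avoids [] w ≡ true
avoids-[] []      = refl
avoids-[] (_ ∷ w) = avoids-[] w

twice-count-difference : ∀ n (p q : List ℤ → Bool) (f : List ℤ → ℤ) →
  (∀ y w → let a = distinct (map ∣_∣ (y ∷ w)) in
           + 2 * (𝟙 a * 𝟙 (p (y ∷ w)) - 𝟙 a * 𝟙 (q (y ∷ w))) ≡ f (y ∷ w)) →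
  + 2 * (+ count p (signedPerms (suc n)) - + count q (signedPerms (suc n))) ≡ Σ f (words (suc n) (suc n))
twice-count-difference n p q f pointwise = begin
  + 2 * (+ count p SP - + count q SP)
    ≡⟨ cong (+ 2 *_) (cong₂ _-_ (count≡Σ𝟙 p SP) (count≡Σ𝟙 q SP)) ⟩
  + 2 * (Σ (λ w → 𝟙 (p w)) SP - Σ (λ w → 𝟙 (q w)) SP)
    ≡⟨ cong (+ 2 *_) (cong₂ _-_ (Σ-filterᵇ dist (λ w → 𝟙 (p w)) W) (Σ-filterᵇ dist (λ w → 𝟙 (q w)) W)) ⟩
  + 2 * (Σ (λ w → 𝟙 (dist w) * 𝟙 (p w)) W - Σ (λ w → 𝟙 (dist w) * 𝟙 (q w)) W)
    ≡⟨ cong (λ z → + 2 * (Σ (λ w → 𝟙 (dist w) * 𝟙 (p w)) W + z)) (Σ-neg (λ w → 𝟙 (dist w) * 𝟙 (q w)) W) ⟨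
  + 2 * (Σ (λ w → 𝟙 (dist w) * 𝟙 (p w)) W + Σ (λ w → - (𝟙 (dist w) * 𝟙 (q w))) W)
    ≡⟨ cong (+ 2 *_) (Σ-+ _ _ W) ⟨
  + 2 * Σ (λ w → 𝟙 (dist w) * 𝟙 (p w) - 𝟙 (dist w) * 𝟙 (q w)) W
    ≡⟨ Σ-*ˡ (+ 2) _ W ⟨
  Σ (λ w → + 2 * (𝟙 (dist w) * 𝟙 (p w) - 𝟙 (dist w) * 𝟙 (q w))) W
    ≡⟨ Σ-cong-All (words-IsWord (suc n) (suc n)) (λ {w} → nonempty w) ⟩
  Σ f W ∎
  where
  open ≡-Reasoning
  SP = signedPerms (suc n)
  W = words (suc n) (suc n)
  dist : List ℤ → Bool
  dist w = distinct (map ∣_∣ w)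
  nonempty : ∀ w → IsWord (suc n) (suc n) w → + 2 * (𝟙 (dist w) * 𝟙 (p w) - 𝟙 (dist w) * 𝟙 (q w)) ≡ f w
  nonempty (y ∷ w) _ = pointwise y w

-- 2 [neg even] = 1 + (-1)^neg, 2 [neg odd] = 1 - (-1)^neg, [inv_D even] - [inv_D odd] = (-1)^inv_D.
weights± : Bool → List ℤ → ℤ
weights± b w = weight false [] (+ 0) false w + signᵇ b * weight true [] (+ 0) false w

2Δ≡Σweights : ∀ n b → let class = λ w → if b then inD w else not (inD w) in
  + 2 * (+ count (λ w → isSnake w ∧ class w ∧ isEven (invD w)) (signedPerms (suc n))
         - + count (λ w → isSnake w ∧ class w ∧ not (isEven (invD w))) (signedPerms (suc n)))
  ≡ Σ (weights± b) (words (suc n) (suc n))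
2Δ≡Σweights n b = twice-count-difference n _ _ (weights± b) pointwise
  where
  table : ∀ b a s i e →
    + 2 * (𝟙 a * 𝟙 (s ∧ (if b then i else not i) ∧ e) - 𝟙 a * 𝟙 (s ∧ (if b then i else not i) ∧ not e))
      ≡ 𝟙 (a ∧ true ∧ s) * (+ 1 * signᵇ e) + signᵇ b * (𝟙 (a ∧ true ∧ s) * (signᵇ i * signᵇ e))
  table true  true  true  true  true  = refl
  table true  true  true  true  false = refl
  table true  true  true  false true  = refl
  table true  true  true  false false = refl
  table true  true  false i     e     = refl
  table true  false s     i     e     = refl
  table false true  true  true  true  = refl
  table false true  true  true  false = refl
  table false true  true  false true  = refl
  table false true  true  false false = refl
  table false true  false i     e     = refl
  table false false s     i     e     = refl
  class : List ℤ → Bool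
  class w = if b then inD w else not (inD w)
  pointwise : ∀ y w → let a = distinct (map ∣_∣ (y ∷ w)); snake = isSnake (y ∷ w); even = isEven (invD (y ∷ w)) in
    + 2 * (𝟙 a * 𝟙 (snake ∧ class (y ∷ w) ∧ even) - 𝟙 a * 𝟙 (snake ∧ class (y ∷ w) ∧ not even)) ≡ weights± b (y ∷ w)
  pointwise y w rewrite avoids-[] (y ∷ w) | sign≡signᵇ-isEven (invD (y ∷ w)) | sign≡signᵇ-isEven (negCount (y ∷ w)) =
    table b (distinct (map ∣_∣ (y ∷ w))) (isSnake (y ∷ w)) (inD (y ∷ w)) (isEven (invD (y ∷ w)))

Σweights± : ∀ n b → Σ (weights± b) (words n n) ≡ ε n + signᵇ b * ε n
Σweights± n b = begin
  Σ (weights± b) (words n n)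
    ≡⟨ Σ-+ (weight false [] (+ 0) false) (λ w → signᵇ b * weight true [] (+ 0) false w) (words n n) ⟩
  tailSum false n n [] (+ 0) false + Σ (λ w → signᵇ b * weight true [] (+ 0) false w) (words n n)
    ≡⟨ cong (_+_ (tailSum false n n [] (+ 0) false)) (Σ-*ˡ (signᵇ b) (weight true [] (+ 0) false) (words n n)) ⟩
  tailSum false n n [] (+ 0) false + signᵇ b * tailSum true n n [] (+ 0) false
    ≡⟨ cong₂ (λ a c → a + signᵇ b * c) (snakeSum false n) (snakeSum true n) ⟩
  ε n + signᵇ b * ε n ∎
  where open ≡-Reasoning

ΔD-value : ∀ n → ΔD (suc n) ≡ ε (suc n)
ΔD-value n = ℤ.*-cancelˡ-≡ (+ 2) _ _ (begin
  + 2 * ΔD (suc n)                          ≡⟨ 2Δ≡Σweights n true ⟩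
  Σ (weights± true) (words (suc n) (suc n)) ≡⟨ Σweights± (suc n) true ⟩
  ε (suc n) + + 1 * ε (suc n)               ≡⟨ double (ε (suc n)) ⟩
  + 2 * ε (suc n)                           ∎)
  where
  open ≡-Reasoning
  double : ∀ a → a + + 1 * a ≡ + 2 * a
  double = solve-∀

ΔBD-value : ∀ n → ΔBD (suc n) ≡ + 0
ΔBD-value n = ℤ.*-cancelˡ-≡ (+ 2) _ _ (begin
  + 2 * ΔBD (suc n)                          ≡⟨ 2Δ≡Σweights n false ⟩
  Σ (weights± false) (words (suc n) (suc n)) ≡⟨ Σweights± (suc n) false ⟩
  ε (suc n) + - + 1 * ε (suc n)              ≡⟨ cancel (ε (suc n)) ⟩
  + 2 * + 0                                  ∎)
  where
  open ≡-Reasoning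
  cancel : ∀ a → a + - + 1 * a ≡ + 2 * + 0
  cancel = solve-∀

theorem67 : ((n : ℕ) → 3 ≤ n →
               (ΔD n ≡ - ΔD (n ∸ 2)) × (ΔBD n ≡ - ΔBD (n ∸ 2)))
            × ((n : ℕ) → 1 ≤ n →
               ((n % 4 ≡ 0 ⊎ n % 4 ≡ 1) → ΔD n ≡ + 1)
               × ((n % 4 ≡ 2 ⊎ n % 4 ≡ 3) → ΔD n ≡ - (+ 1))
               × (ΔBD n ≡ + 0))
theorem67 = recurrence , closedForm
  where
  recurrence : (n : ℕ) → 3 ≤ n → (ΔD n ≡ - ΔD (n ∸ 2)) × (ΔBD n ≡ - ΔBD (n ∸ 2))
  recurrence (suc (suc (suc m))) (s≤s (s≤s (s≤s z≤n))) =
    trans (ΔD-value (suc (suc m))) (trans (ε-suc-suc (suc m)) (cong -_ (sym (ΔD-value m)))) ,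
    trans (ΔBD-value (suc (suc m))) (cong -_ (sym (ΔBD-value m)))
  closedForm : (n : ℕ) → 1 ≤ n → ((n % 4 ≡ 0 ⊎ n % 4 ≡ 1) → ΔD n ≡ + 1)
                                 × ((n % 4 ≡ 2 ⊎ n % 4 ≡ 3) → ΔD n ≡ - (+ 1)) × (ΔBD n ≡ + 0)
  closedForm (suc m) (s≤s z≤n) = (λ n%4 → trans (ΔD-value m) (ε≡1 (suc m) n%4)) ,
                                 (λ n%4 → trans (ΔD-value m) (ε≡-1 (suc m) n%4)) ,
                                 ΔBD-value m
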